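{- Let $G$ be a finite group and $C$ an inclusion-minimal generating set of $G$. If ${\it Cay}(G,C)$ is planar and every vertex of ${\it Cay}(G,C)$ has degree at least $3$, then ${\it Cay}(G\times R_2,C\times R_2)$ cannot be (2-cell) embedded on the torus.
   Context: A right zero semigroup is $R_2=\{r_1,r_2\}$ with multiplication $r_ir_j=r_j$; $G\times R_2$ is the direct product semigroup with $(g,r_i)(h,r_j)=(gh,r_j)$. For a semigroup $S$ and $C\subseteq S$, ${\it Cay}(S,C)$ is the simple undirected graph with vertex set $S$ in which distinct $s_1,s_2$ are adjacent iff $s_1c=s_2$ or $s_2c=s_1$ for some $c\in C$ (loops and multiple edges deleted). A graph is (2-cell) embedded in a surface $M$ if it is drawn in $M$ with edges meeting only at common endpoints such that the complement of the graph in $M$ is a disjoint union of open disks. The torus is the orientable surface of genus $1$. An inclusion-minimal generating set is a generating set with no proper generating subset. -}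

module Defs where

open import Data.Nat using (ℕ; zero; suc; _+_; _*_)
open import Data.Fin using (Fin)
open import Data.Bool using (Bool; true; false; if_then_else_)
open import Data.List using (List; []; _∷_)
open import Data.List.Relation.Unary.All using (All)
open import Data.Product using (Σ; ∃; _×_; _,_; proj₁; proj₂)
open import Data.Sum using (_⊎_)
open import Relation.Binary.PropositionalEquality using (_≡_; _≢_; sym)
open import Relation.Unary using (Pred; _⊆_)
open import Function.Bundles using (_↔_)
open import Level using (0ℓ)

iter : {A : Set} → (A → A) → ℕ → A → A
iter f zero    x = x
iter f (suc k) x = f (iter f k x)

-- Simple undirected graphs (adjacency symmetric, loops excluded by the
-- users below).  Vertex set V, adjacency relation Adj.

record Graph : Set₁ where
  field
    V      : Set
    Adj    : V → V → Set
    Adj-sym : ∀ {u v} → Adj u v → Adj v u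

-- A dart (directed edge / arc) of a simple graph: the adjacency proof is
-- irrelevant, so there is exactly one dart u→v for each adjacent pair.
record Dart (Γ : Graph) : Set where
  constructor dart
  open Graph Γ
  field
    tail : V
    head : V
    .adj : Adj tail head

module _ {Γ : Graph} where
  open Graph Γ
  open Dart

  rev : Dart Γ → Dart Γ
  rev (dart u v a) = dart v u (Adj-sym a)

MinDegree≥3 : Graph → Set
MinDegree≥3 Γ = ∀ v → Σ V λ a → Σ V λ b → Σ V λ c →
  Adj v a × Adj v b × Adj v c × a ≢ b × a ≢ c × b ≢ c
  where open Graph Γ

-- Rotation systems: combinatorial description of 2-cell embeddings of a
-- graph in an orientable surface (Heffter–Edmonds–Ringel).
-- rot d is the successor of d in the cyclic order of darts around tail d.

record RotationSystem (Γ : Graph) : Set where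
  open Dart
  field
    rot      : Dart Γ → Dart Γ
    rot⁻¹    : Dart Γ → Dart Γ
    rot-inv₁ : ∀ d → rot (rot⁻¹ d) ≡ d
    rot-inv₂ : ∀ d → rot⁻¹ (rot d) ≡ d
    rot-tail : ∀ d → tail (rot d) ≡ tail d
    rot-cyclic : ∀ d d' → tail d ≡ tail d' → ∃ λ k → iter rot k d ≡ d'

  face : Dart Γ → Dart Γ
  face d = rot (rev d)

-- Γ has a 2-cell embedding in the orientable surface of genus g:
-- a rotation system whose faces (orbits of the face-tracing permutation),
-- counted as F via representatives, satisfy Euler's formula
--   |V| - |E| + F = 2 - 2g,   with |D| = 2|E|,
-- written in ℕ as  2|V| + 2F + 4g = |D| + 4.
-- (Euler's formula identifies the genus for connected graphs; all graphs
-- to which this is applied are connected Cayley graphs.)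
Embeds2Cell : Graph → ℕ → Set
Embeds2Cell Γ g =
  Σ (RotationSystem Γ) λ ρ → let open RotationSystem ρ in
  Σ ℕ λ nV → Σ ℕ λ nD → Σ ℕ λ F →
  (Graph.V Γ ↔ Fin nV) × (Dart Γ ↔ Fin nD) ×
  (Σ (Fin F → Dart Γ) λ rep →
      (∀ d → ∃ λ i → ∃ λ k → iter face k (rep i) ≡ d)
    × (∀ i j k → iter face k (rep i) ≡ rep j → i ≡ j)) ×
  (2 * nV + 2 * F + 4 * g ≡ nD + 4)

Planar : Graph → Set
Planar Γ = Embeds2Cell Γ 0

Cay : (S : Set) → (S → S → S) → Pred S 0ℓ → Graph
Cay S _·_ C = record
  { V = S
  ; Adj = λ s₁ s₂ → s₁ ≢ s₂ × ∃ λ c → C c × (s₁ · c ≡ s₂ ⊎ s₂ · c ≡ s₁)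
  ; Adj-sym = λ { (ne , c , cC , Data.Sum.inj₁ e) → (λ eq → ne (sym eq)) , c , cC , Data.Sum.inj₂ e
                ; (ne , c , cC , Data.Sum.inj₂ e) → (λ eq → ne (sym eq)) , c , cC , Data.Sum.inj₁ e } }

module _ {A : Set} (_∙_ : A → A → A) (ε : A) (_⁻¹ : A → A) where

  evalWord : List (Bool × A) → A
  evalWord []              = ε
  evalWord ((b , c) ∷ w)   = (if b then c else (c ⁻¹)) ∙ evalWord w

  Generates : Pred A 0ℓ → Set
  Generates C = ∀ x → ∃ λ (w : List (Bool × A)) →
    All (λ p → C (proj₂ p)) w × evalWord w ≡ x

  MinimalGenerating : Pred A 0ℓ → Set₁
  MinimalGenerating C = Generates C × (∀ (C' : Pred A 0ℓ) → C' ⊆ C → Generates C' → C ⊆ C')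

-- Right zero semigroup R₂ = {r₁ , r₂} (as Fin 2), direct product G × R₂
-- and connection set C × R₂.

R₂ : Set
R₂ = Fin 2

_·R₂_ : R₂ → R₂ → R₂
_ ·R₂ j = j

×R₂-mul : {A : Set} → (A → A → A) → (A × R₂) → (A × R₂) → (A × R₂)
×R₂-mul _∙_ (g , i) (h , j) = (g ∙ h , i ·R₂ j)

_×R₂ : {A : Set} → Pred A 0ℓ → Pred (A × R₂) 0ℓ
(C ×R₂) (c , r) = C c

{-# OPTIONS --safe #-}
-- In Cay(G × R₂, C × R₂) the vertex (g, r) is joined to (g s, r′) for every neighbour s
-- of 1 in Cay(G, C) and both r′, so |D| ≥ 2·deg(1)·|V| ≥ 6|V|.  On the torus Euler's
-- formula reads 2|V| + 2F = |D|, and since faces have length at least 3 we get 3F ≤ |D|,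
-- hence |D| ≤ 6|V|.  So 1 has exactly three neighbours and every face is a triangle.
-- Inversion permutes those three neighbours, so one of them, x, is an involution, hence
-- x ∈ C.  The triangle on the edge (1, r₁)(x, r₁) yields a common neighbour t of 1 and x,
-- and x = t · (t⁻¹ x) is a product of two letters over C ∖ {x}, contradicting minimality.
module Submission where

open import Defs
open import Algebra.Bundles using (Group)
open import Algebra.Structures using (IsGroup)
open import Data.Bool using (Bool; true; false; not; if_then_else_)
open import Data.Empty using (⊥; ⊥-elim)
import Data.Empty.Irrelevant as Irrelevant
open import Data.Fin using (Fin; zero; suc; toℕ) renaming (_≟_ to _≟ᶠ_)
open import Data.Fin.Properties using (injective⇒≤; any?; *↔×; nonZeroIndex)
open import Data.List using (List; []; _∷_; _++_)
open import Data.List.Relation.Unary.All using (All; []; _∷_)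
open import Data.List.Relation.Unary.All.Properties using (++⁺)
open import Data.Nat using (ℕ; zero; suc; _+_; _*_; _≤_; _≤?_)
open import Data.Nat.Properties
  using ( +-comm; +-cancelʳ-≡; +-cancelʳ-≤; +-monoʳ-≤; +-monoˡ-≤; *-monoʳ-≤; *-cancelˡ-≤
        ; ≤-trans; ≤⇒≯; module ≤-Reasoning)
open import Data.Nat.Tactic.RingSolver using (solve-∀)
open import Data.Product using (∃; ∃₂; _×_; _,_; proj₁; proj₂)
open import Data.Product.Function.NonDependent.Propositional using (_×-↔_)
open import Data.Sum using (_⊎_; inj₁; inj₂)
import Data.Sum as Sum
open import Data.Vec.Functional using (Vector) renaming ([] to []ᵥ; _∷_ to _∷ᵥ_)
open import Function using (_∘_)
open import Function.Bundles using (_↔_; _↣_; Inverse; Injection; mk↣)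
open import Function.Construct.Composition using (_↣-∘_)
open import Function.Definitions using (Injective)
open import Function.Properties.Inverse using (↔⇒↣; ↔-sym; ↔-trans)
open import Level using (0ℓ)
open import Relation.Binary.Definitions using (DecidableEquality)
open import Relation.Binary.PropositionalEquality
  using (_≡_; _≢_; refl; sym; trans; cong; cong₂; subst; module ≡-Reasoning)
open import Relation.Nullary using (¬_; yes; no)
open import Relation.Nullary.Decidable using (via-injection; from-no)
open import Relation.Unary using (Pred; _∖_; ｛_｝)

private
  variable
    X Y : Set
    m n : ℕ

iter-+ : (f : X → X) (k l : ℕ) (x : X) → iter f (k + l) x ≡ iter f k (iter f l x)
iter-+ f zero    l x = refl
iter-+ f (suc k) l x = cong f (iter-+ f k l x)

iter-comm : (f : X → X) (k l : ℕ) (x : X) → iter f k (iter f l x) ≡ iter f l (iter f k x)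
iter-comm f k l x = trans (sym (iter-+ f k l x)) (trans (cong (λ j → iter f j x) (+-comm k l)) (iter-+ f l k x))

iter-fixpoint : {f : X → X} {x : X} → f x ≡ x → ∀ k → iter f k x ≡ x
iter-fixpoint         fx≡x zero    = refl
iter-fixpoint {f = f} fx≡x (suc k) = trans (cong f (iter-fixpoint fx≡x k)) fx≡x

[]-injective : Injective _≡_ _≡_ ([]ᵥ {A = X})
[]-injective {x = ()}

∷-injective : {x : X} {xs : Vector X n} →
              Injective _≡_ _≡_ xs → (∀ p → xs p ≢ x) → Injective _≡_ _≡_ (x ∷ᵥ xs)
∷-injective xs-inj x∉xs {zero}  {zero}  _  = refl
∷-injective xs-inj x∉xs {zero}  {suc q} eq = ⊥-elim (x∉xs q (sym eq))
∷-injective xs-inj x∉xs {suc p} {zero}  eq = ⊥-elim (x∉xs p eq)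
∷-injective xs-inj x∉xs {suc p} {suc q} eq = cong suc (xs-inj eq)

distinct₃ : {a b c : X} → a ≢ b → a ≢ c → b ≢ c → Injective _≡_ _≡_ (a ∷ᵥ b ∷ᵥ c ∷ᵥ []ᵥ)
distinct₃ a≢b a≢c b≢c =
  ∷-injective (∷-injective (∷-injective []-injective λ ())
                           λ { zero c≡b → b≢c (sym c≡b) })
              λ { zero b≡a → a≢b (sym b≡a) ; (suc zero) c≡a → a≢c (sym c≡a) }

fin-injective⇒surjective : {f : Fin m → Fin n} → Injective _≡_ _≡_ f → n ≤ m →
                           ∀ y → ∃ λ x → f x ≡ y
fin-injective⇒surjective {f = f} f-inj n≤m y with any? (λ x → f x ≟ᶠ y)
... | yes hit = hit
... | no miss = ⊥-elim (≤⇒≯ n≤m (injective⇒≤ (∷-injective f-inj λ x fx≡y → miss (x , fx≡y))))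

module _ (X↔ : X ↔ Fin m) (Y↔ : Y ↔ Fin n) (f : X ↣ Y) where

  private
    fin-f : Fin m ↣ Fin n
    fin-f = ↔⇒↣ Y↔ ↣-∘ (f ↣-∘ ↔⇒↣ (↔-sym X↔))

  ↣⇒≤ : m ≤ n
  ↣⇒≤ = injective⇒≤ (Injection.injective fin-f)

  ↣⇒surjective : n ≤ m → ∀ y → ∃ λ x → Injection.to f x ≡ y
  ↣⇒surjective n≤m y with fin-injective⇒surjective (Injection.injective fin-f) n≤m (Inverse.to Y↔ y)
  ... | k , fk≡y = Inverse.from X↔ k , Injection.injective (↔⇒↣ Y↔) fk≡y

involution-swap : {f : X → X} → (∀ x → f (f x) ≡ x) → ∀ {x y} → f x ≡ y → f y ≡ x
involution-swap {f = f} f-inv {x} fx≡y = trans (cong f (sym fx≡y)) (f-inv x)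

involution-on-three-has-fixpoint :
  {P : Pred X 0ℓ} {f : X → X} {a b c : X} →
  (∀ x → f (f x) ≡ x) → (∀ {x} → P x → P (f x)) → P a → P b → P c →
  a ≢ b → a ≢ c → b ≢ c → (∀ {x} → P x → x ≡ a ⊎ x ≡ b ⊎ x ≡ c) →
  ∃ λ x → P x × f x ≡ x
involution-on-three-has-fixpoint f-inv P-f Pa Pb Pc a≢b a≢c b≢c only-abc
  with only-abc (P-f Pa)
... | inj₁ fa≡a = _ , Pa , fa≡a
... | inj₂ (inj₁ fa≡b) with only-abc (P-f Pc)
...   | inj₁ fc≡a        = ⊥-elim (b≢c (trans (sym fa≡b) (involution-swap f-inv fc≡a)))
...   | inj₂ (inj₁ fc≡b) = ⊥-elim (a≢c (trans (sym (involution-swap f-inv fa≡b)) (involution-swap f-inv fc≡b)))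
...   | inj₂ (inj₂ fc≡c) = _ , Pc , fc≡c
involution-on-three-has-fixpoint f-inv P-f Pa Pb Pc a≢b a≢c b≢c only-abc
  | inj₂ (inj₂ fa≡c) with only-abc (P-f Pb)
...   | inj₁ fb≡a        = ⊥-elim (b≢c (trans (sym (involution-swap f-inv fb≡a)) fa≡c))
...   | inj₂ (inj₁ fb≡b) = _ , Pb , fb≡b
...   | inj₂ (inj₂ fb≡c) = ⊥-elim (a≢b (trans (sym (involution-swap f-inv fa≡c)) (involution-swap f-inv fb≡c)))

euler-torus-≤ : ∀ {v f d} → 2 * v + 2 * f ≡ d → f * 3 ≤ d → d ≤ v * 6
euler-torus-≤ {v} {f} refl 3f≤d = begin
  2 * v + 2 * f       ≤⟨ +-monoʳ-≤ (2 * v) (*-monoʳ-≤ 2 f≤2v) ⟩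
  2 * v + 2 * (2 * v) ≡⟨ six v ⟩
  v * 6               ∎
  where
  open ≤-Reasoning
  three : ∀ f → f * 3 ≡ f + 2 * f
  three = solve-∀
  six : ∀ v → 2 * v + 2 * (2 * v) ≡ v * 6
  six = solve-∀
  f≤2v : f ≤ 2 * v
  f≤2v = +-cancelʳ-≤ (2 * f) f (2 * v) (subst (_≤ 2 * v + 2 * f) (three f) 3f≤d)

euler-torus-≥ : ∀ {v f d} → 2 * v + 2 * f ≡ d → v * 6 ≤ d → d ≤ f * 3
euler-torus-≥ {v} {f} refl 6v≤d = begin
  2 * v + 2 * f ≤⟨ +-monoˡ-≤ (2 * f) 2v≤f ⟩
  f + 2 * f     ≡⟨ three f ⟩
  f * 3         ∎
  where
  open ≤-Reasoning
  three : ∀ f → f + 2 * f ≡ f * 3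
  three = solve-∀
  six : ∀ v → v * 6 ≡ 2 * (2 * v) + 2 * v
  six = solve-∀
  2v≤f : 2 * v ≤ f
  2v≤f = *-cancelˡ-≤ 2 (+-cancelʳ-≤ (2 * v) (2 * (2 * v)) (2 * f)
           (subst (_≤ 2 * f + 2 * v) (six v) (subst (v * 6 ≤_) (+-comm (2 * v) (2 * f)) 6v≤d)))

module Darts {Γ : Graph} where
  open Graph Γ
  open Dart

  dart-≡ : {d d' : Dart Γ} → tail d ≡ tail d' → head d ≡ head d' → d ≡ d'
  dart-≡ {dart u v _} {dart .u .v _} refl refl = refl

  TwoDartsAtEachVertex : Set
  TwoDartsAtEachVertex = ∀ v → ∃₂ λ (d d' : Dart Γ) → tail d ≡ v × tail d' ≡ v × d ≢ d'

  out-darts-≤ : {K : Set} {nV k nD : ℕ} (out : V → K → Dart Γ) →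
                (∀ v p → tail (out v p) ≡ v) → (∀ v → Injective _≡_ _≡_ (out v)) →
                V ↔ Fin nV → K ↔ Fin k → Dart Γ ↔ Fin nD → nV * k ≤ nD
  out-darts-≤ out out-tail out-injective V↔ K↔ D↔ =
    ↣⇒≤ (↔-trans (V↔ ×-↔ K↔) (↔-sym *↔×)) D↔ (mk↣ {to = λ (v , p) → out v p} injective)
    where
    injective : Injective _≡_ _≡_ (λ (v , p) → out v p)
    injective {v , p} {v' , p'} eq with trans (sym (out-tail v p)) (trans (cong tail eq) (out-tail v' p'))
    ... | refl = cong (v ,_) (out-injective v eq)

module RotationSystemProperties {Γ : Graph} (ρ : RotationSystem Γ) where
  open Graph Γ
  open Dart
  open RotationSystem ρ
  open Darts {Γ}

  tail-face : ∀ d → tail (face d) ≡ head d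
  tail-face d = rot-tail (rev d)

  rot-injective : Injective _≡_ _≡_ rot
  rot-injective {d} {d'} eq = trans (sym (rot-inv₂ d)) (trans (cong rot⁻¹ eq) (rot-inv₂ d'))

  face-injective : Injective _≡_ _≡_ face
  face-injective eq = cong rev (rot-injective eq)

  rot-fixpoint-unique : ∀ {r d} → rot r ≡ r → tail r ≡ tail d → r ≡ d
  rot-fixpoint-unique {r} {d} rot-r≡r same-tail with rot-cyclic r d same-tail
  ... | k , r↦d = trans (sym (iter-fixpoint rot-r≡r k)) r↦d

  rot-fixpoint-free : TwoDartsAtEachVertex → ∀ r → rot r ≢ r
  rot-fixpoint-free two-darts r rot-r≡r with two-darts (tail r)
  ... | d , d' , refl , d'-tail , d≢d' =
    d≢d' (trans (sym (rot-fixpoint-unique rot-r≡r refl)) (rot-fixpoint-unique rot-r≡r (sym d'-tail)))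

  face-fixpoint-free : (∀ {u v} → Adj u v → u ≢ v) → ∀ d → face d ≢ d
  face-fixpoint-free loopless d@(dart u v u~v) face-d≡d =
    Irrelevant.⊥-elim (loopless u~v (trans (sym (cong tail face-d≡d)) (tail-face d)))

  face²-fixpoint-free : TwoDartsAtEachVertex → ∀ d → face (face d) ≢ d
  face²-fixpoint-free two-darts d face²-d≡d = rot-fixpoint-free two-darts (rev d)
    (dart-≡ (tail-face d) (trans (sym (tail-face (face d))) (cong tail face²-d≡d)))

  face³-fixpoint-free : ∀ d → (∀ w → Adj (head d) w → Adj w (tail d) → ⊥) →
                        face (face (face d)) ≢ d
  face³-fixpoint-free d no-triangle face³-d≡d =
    closes (face d) (face (face d)) (tail-face d) (tail-face (face d))
           (trans (sym (tail-face (face (face d)))) (cong tail face³-d≡d))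
    where
    closes : ∀ e e' → tail e ≡ head d → tail e' ≡ head e → head e' ≡ tail d → ⊥
    closes (dart _ w d~w) (dart _ _ w~d) refl refl refl = Irrelevant.⊥-elim (no-triangle w d~w w~d)

  module Corners {F : ℕ} (rep : Fin F → Dart Γ)
                 (rep-unique : ∀ i j k → iter face k (rep i) ≡ rep j → i ≡ j)
                 (face¹-free : ∀ d → face d ≢ d) (face²-free : ∀ d → face (face d) ≢ d) where

    corner : Fin F × Fin 3 → Dart Γ
    corner (i , k) = iter face (toℕ k) (rep i)

    rep≢face : ∀ i j → rep j ≢ face (rep i)
    rep≢face i j eq with rep-unique i j 1 (sym eq)
    ... | refl = face¹-free (rep i) (sym eq)

    rep≢face² : ∀ i j → rep j ≢ face (face (rep i))
    rep≢face² i j eq with rep-unique i j 2 (sym eq)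
    ... | refl = face²-free (rep i) (sym eq)

    corner-injective : Injective _≡_ _≡_ corner
    corner-injective {i , zero} {j , zero} eq with rep-unique i j 0 eq
    ... | refl = refl
    corner-injective {i , zero}             {j , suc zero}       eq = ⊥-elim (rep≢face j i eq)
    corner-injective {i , zero}             {j , suc (suc zero)} eq = ⊥-elim (rep≢face² j i eq)
    corner-injective {i , suc zero}         {j , zero}           eq = ⊥-elim (rep≢face i j (sym eq))
    corner-injective {i , suc (suc zero)}   {j , zero}           eq = ⊥-elim (rep≢face² i j (sym eq))
    corner-injective {i , suc zero}         {j , suc zero}       eq with rep-unique i j 0 (face-injective eq)
    ... | refl = refl
    corner-injective {i , suc zero}         {j , suc (suc zero)} eq = ⊥-elim (rep≢face j i (face-injective eq))
    corner-injective {i , suc (suc zero)}   {j , suc zero}       eq = ⊥-elim (rep≢face i j (sym (face-injective eq)))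
    corner-injective {i , suc (suc zero)}   {j , suc (suc zero)} eq
      with rep-unique i j 0 (face-injective (face-injective eq))
    ... | refl = refl

    module _ {nD : ℕ} (D↔ : Dart Γ ↔ Fin nD) where

      corners-≤ : F * 3 ≤ nD
      corners-≤ = ↣⇒≤ (↔-sym *↔×) D↔ (mk↣ corner-injective)

      module _ (nD≤3F : nD ≤ F * 3) where

        corner-surjective : ∀ d → ∃ λ p → corner p ≡ d
        corner-surjective = ↣⇒surjective (↔-sym *↔×) D↔ (mk↣ corner-injective) nD≤3F

        rep-triangle : ∀ i → iter face 3 (rep i) ≡ rep i
        rep-triangle i with corner-surjective (iter face 3 (rep i))
        ... | (j , zero) , eq with rep-unique i j 3 (sym eq)
        ...   | refl = sym eq
        rep-triangle i | (j , suc zero)       , eq = ⊥-elim (rep≢face² i j (face-injective eq))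
        rep-triangle i | (j , suc (suc zero)) , eq = ⊥-elim (rep≢face i j (face-injective (face-injective eq)))

        all-faces-triangles : ∀ d → face (face (face d)) ≡ d
        all-faces-triangles d with corner-surjective d
        ... | (i , k) , corner≡d = begin
          iter face 3 d                            ≡⟨ cong (iter face 3) (sym corner≡d) ⟩
          iter face 3 (iter face (toℕ k) (rep i)) ≡⟨ iter-comm face 3 (toℕ k) (rep i) ⟩
          iter face (toℕ k) (iter face 3 (rep i)) ≡⟨ cong (iter face (toℕ k)) (rep-triangle i) ⟩
          iter face (toℕ k) (rep i)               ≡⟨ corner≡d ⟩
          d                                        ∎
          where open ≡-Reasoning

module GroupWords {A : Set} {_∙_ : A → A → A} {ε : A} {_⁻¹ : A → A}
                  (isGroup : IsGroup _≡_ _∙_ ε _⁻¹) where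

  group : Group 0ℓ 0ℓ
  group = record { isGroup = isGroup }

  open IsGroup isGroup using (assoc; identityˡ; identityʳ; inverseˡ; inverseʳ)
  open import Algebra.Properties.Group group
    using ( ⁻¹-involutive; ⁻¹-anti-homo-∙; ⁻¹-injective; ε⁻¹≈ε; inverseˡ-unique
          ; identityˡ-unique; identityʳ-unique; ∙-cancelˡ)

  Word : Set
  Word = List (Bool × A)

  Over : Pred A 0ℓ → Pred Word 0ℓ
  Over P = All (P ∘ proj₂)

  letter : Bool × A → A
  letter (b , c) = if b then c else (c ⁻¹)

  eval : Word → A
  eval = evalWord _∙_ ε _⁻¹

  eval-++ : ∀ u v → eval (u ++ v) ≡ eval u ∙ eval v
  eval-++ []      v = sym (identityˡ (eval v))
  eval-++ (l ∷ u) v = trans (cong (letter l ∙_) (eval-++ u v)) (sym (assoc (letter l) (eval u) (eval v)))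

  letter-not : ∀ b c → letter (not b , c) ≡ letter (b , c) ⁻¹
  letter-not true  c = refl
  letter-not false c = sym (⁻¹-involutive c)

  inverseWord : Word → Word
  inverseWord []            = []
  inverseWord ((b , c) ∷ w) = inverseWord w ++ (not b , c) ∷ []

  eval-inverseWord : ∀ w → eval (inverseWord w) ≡ eval w ⁻¹
  eval-inverseWord []            = sym ε⁻¹≈ε
  eval-inverseWord ((b , c) ∷ w) = begin
    eval (inverseWord w ++ (not b , c) ∷ [])      ≡⟨ eval-++ (inverseWord w) _ ⟩
    eval (inverseWord w) ∙ (letter (not b , c) ∙ ε) ≡⟨ cong₂ _∙_ (eval-inverseWord w) (trans (identityʳ _) (letter-not b c)) ⟩
    (eval w ⁻¹) ∙ (letter (b , c) ⁻¹)              ≡⟨ sym (⁻¹-anti-homo-∙ (letter (b , c)) (eval w)) ⟩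
    (letter (b , c) ∙ eval w) ⁻¹                   ∎
    where open ≡-Reasoning

  Over-inverseWord : ∀ {P} w → Over P w → Over P (inverseWord w)
  Over-inverseWord []            []         = []
  Over-inverseWord ((b , c) ∷ w) (Pc ∷ Pw) = ++⁺ (Over-inverseWord w Pw) (Pc ∷ [])

  module CayleyGraph (C : Pred A 0ℓ) where

    Γ : Graph
    Γ = Cay A _∙_ C

    Γ₂ : Graph
    Γ₂ = Cay (A × R₂) (×R₂-mul _∙_) (C ×R₂)

    open Graph Γ using (Adj; Adj-sym) public
    open Graph Γ₂ using () renaming (Adj to Adj₂) public

    Adj-translate : ∀ k {g h} → Adj g h → Adj (k ∙ g) (k ∙ h)
    Adj-translate k {g} {h} (g≢h , c , Cc , edge) =
      (λ kg≡kh → g≢h (∙-cancelˡ k g h kg≡kh)) , c , Cc ,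
      Sum.map (λ gc≡h → trans (assoc k g c) (cong (k ∙_) gc≡h))
              (λ hc≡g → trans (assoc k h c) (cong (k ∙_) hc≡g)) edge

    Adj-from-ε : ∀ g {s} → Adj ε s → Adj g (g ∙ s)
    Adj-from-ε g {s} ε~s = subst (λ x → Adj x (g ∙ s)) (identityʳ g) (Adj-translate g ε~s)

    Adj-to-ε : ∀ {g h} → Adj g h → Adj ε ((g ⁻¹) ∙ h)
    Adj-to-ε {g} {h} g~h = subst (λ x → Adj x ((g ⁻¹) ∙ h)) (inverseˡ g) (Adj-translate (g ⁻¹) g~h)

    neighbour⁻¹ : ∀ {y} → Adj ε y → Adj ε (y ⁻¹)
    neighbour⁻¹ {y} ε~y = subst (Adj ε) (identityʳ (y ⁻¹)) (Adj-to-ε (Adj-sym ε~y))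

    neighbour-letter : ∀ {y} → Adj ε y → ∃ λ l → C (proj₂ l) × letter l ≡ y
    neighbour-letter (_ , c , Cc , inj₁ εc≡y) = (true , c) , Cc , trans (sym (identityˡ c)) εc≡y
    neighbour-letter (_ , c , Cc , inj₂ yc≡ε) = (false , c) , Cc , sym (inverseˡ-unique _ c yc≡ε)

    self-inverse-neighbour∈C : ∀ {y} → Adj ε y → y ⁻¹ ≡ y → C y
    self-inverse-neighbour∈C ε~y y⁻¹≡y with neighbour-letter ε~y
    ... | (true  , c) , Cc , refl = Cc
    ... | (false , c) , Cc , refl = subst C (⁻¹-injective (sym y⁻¹≡y)) Cc

    Adj-×R₂⁺ : ∀ {g h i j} → Adj g h → Adj₂ (g , i) (h , j)
    Adj-×R₂⁺ {i = i} {j} (g≢h , c , Cc , inj₁ gc≡h) = g≢h ∘ cong proj₁ , (c , j) , Cc , inj₁ (cong (_, j) gc≡h)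
    Adj-×R₂⁺ {i = i} {j} (g≢h , c , Cc , inj₂ hc≡g) = g≢h ∘ cong proj₁ , (c , i) , Cc , inj₂ (cong (_, i) hc≡g)

    edge-distinct : ¬ C ε → ∀ {g h c} → C c → g ∙ c ≡ h → g ≢ h
    edge-distinct ε∉C {g} {c = c} Cc gc≡h refl = ε∉C (subst C (identityʳ-unique g c gc≡h) Cc)

    Adj-×R₂⁻ : ¬ C ε → ∀ {g h i j} → Adj₂ (g , i) (h , j) → Adj g h
    Adj-×R₂⁻ ε∉C (_ , (c , _) , Cc , inj₁ gc≡h) =
      edge-distinct ε∉C Cc (cong proj₁ gc≡h) , c , Cc , inj₁ (cong proj₁ gc≡h)
    Adj-×R₂⁻ ε∉C (_ , (c , _) , Cc , inj₂ hc≡g) =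
      (λ g≡h → edge-distinct ε∉C Cc (cong proj₁ hc≡g) (sym g≡h)) , c , Cc , inj₂ (cong proj₁ hc≡g)

    module Minimal (_≟_ : DecidableEquality A) (minimal : MinimalGenerating _∙_ ε _⁻¹ C) where

      module _ {x : A} {W : Word} (W-avoids-x : Over (C ∖ ｛ x ｝) W) (W≡x : eval W ≡ x) where

        occurrence : Bool → Word
        occurrence true  = W
        occurrence false = inverseWord W

        eval-occurrence : ∀ b → eval (occurrence b) ≡ letter (b , x)
        eval-occurrence true  = W≡x
        eval-occurrence false = trans (eval-inverseWord W) (cong _⁻¹ W≡x)

        occurrence-avoids-x : ∀ b → Over (C ∖ ｛ x ｝) (occurrence b)
        occurrence-avoids-x true  = W-avoids-x
        occurrence-avoids-x false = Over-inverseWord W W-avoids-x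

        eliminate : ∀ w → Over C w → ∃ λ w' → Over (C ∖ ｛ x ｝) w' × eval w' ≡ eval w
        eliminate []            []         = [] , [] , refl
        eliminate ((b , c) ∷ w) (Cc ∷ Cw) with x ≟ c | eliminate w Cw
        ... | no x≢c  | w' , Cw' , w'≡w =
          (b , c) ∷ w' , (Cc , x≢c) ∷ Cw' , cong (letter (b , c) ∙_) w'≡w
        ... | yes refl | w' , Cw' , w'≡w =
          occurrence b ++ w' , ++⁺ (occurrence-avoids-x b) Cw' ,
          trans (eval-++ (occurrence b) w') (cong₂ _∙_ (eval-occurrence b) w'≡w)

      minimal⇒irredundant : ∀ {x} → C x → ∀ W → Over (C ∖ ｛ x ｝) W → eval W ≢ x
      minimal⇒irredundant {x} Cx W W-avoids-x W≡x = proj₂ (proj₂ minimal (C ∖ ｛ x ｝) proj₁ generates Cx) refl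
        where
        generates : Generates _∙_ ε _⁻¹ (C ∖ ｛ x ｝)
        generates y with proj₁ minimal y
        ... | w , Cw , w≡y with eliminate W-avoids-x W≡x w Cw
        ...   | w' , Cw' , w'≡w = w' , Cw' , trans w'≡w w≡y

      ε∉C : ¬ C ε
      ε∉C Cε = minimal⇒irredundant Cε [] [] refl

      neighbour-letter-avoiding : ∀ {x y} → x ⁻¹ ≡ x → Adj ε y → y ≢ x →
                                  ∃ λ l → (C ∖ ｛ x ｝) (proj₂ l) × letter l ≡ y
      neighbour-letter-avoiding {x} {y} x⁻¹≡x ε~y y≢x with neighbour-letter ε~y
      ... | (b , c) , Cc , l≡y = (b , c) , (Cc , x≢c b l≡y) , l≡y
        where
        x≢c : ∀ {c} b → letter (b , c) ≡ y → x ≢ c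
        x≢c true  l≡y refl = y≢x (sym l≡y)
        x≢c false l≡y refl = y≢x (trans (sym l≡y) x⁻¹≡x)

      self-inverse-generator-not-product : ∀ {x y z} → C x → x ⁻¹ ≡ x →
                                           Adj ε y → Adj ε z → y ≢ x → z ≢ x → y ∙ z ≢ x
      self-inverse-generator-not-product Cx x⁻¹≡x ε~y ε~z y≢x z≢x yz≡x
        with neighbour-letter-avoiding x⁻¹≡x ε~y y≢x | neighbour-letter-avoiding x⁻¹≡x ε~z z≢x
      ... | l₁ , l₁-avoids , l₁≡y | l₂ , l₂-avoids , l₂≡z =
        minimal⇒irredundant Cx (l₁ ∷ l₂ ∷ []) (l₁-avoids ∷ l₂-avoids ∷ [])
          (trans (cong₂ _∙_ l₁≡y (trans (identityʳ (letter l₂)) l₂≡z)) yz≡x)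

      self-inverse-generator-in-no-triangle : ∀ {x t} → C x → x ⁻¹ ≡ x → Adj ε t → Adj x t → ⊥
      self-inverse-generator-in-no-triangle {x} {t} Cx x⁻¹≡x ε~t x~t =
        self-inverse-generator-not-product Cx x⁻¹≡x ε~t (Adj-to-ε (Adj-sym x~t)) t≢x s≢x (begin
          t ∙ ((t ⁻¹) ∙ x) ≡⟨ sym (assoc t (t ⁻¹) x) ⟩
          (t ∙ (t ⁻¹)) ∙ x ≡⟨ cong (_∙ x) (inverseʳ t) ⟩
          ε ∙ x            ≡⟨ identityˡ x ⟩
          x                ∎)
        where
        open ≡-Reasoning
        t≢x : t ≢ x
        t≢x t≡x = proj₁ x~t (sym t≡x)
        s≢x : (t ⁻¹) ∙ x ≢ x
        s≢x s≡x = proj₁ ε~t (sym (⁻¹-injective (trans (identityˡ-unique (t ⁻¹) x s≡x) (sym ε⁻¹≈ε))))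

module TorusEmbedding {A : Set} {_∙_ : A → A → A} {ε : A} {_⁻¹ : A → A}
                      (isGroup : IsGroup _≡_ _∙_ ε _⁻¹) {C : Pred A 0ℓ}
                      (_≟_ : DecidableEquality A) (minimal : MinimalGenerating _∙_ ε _⁻¹ C) where

  open GroupWords isGroup
  open CayleyGraph C
  open Minimal _≟_ minimal
  open import Algebra.Properties.Group group using (∙-cancelˡ; ⁻¹-involutive)

  spoke : (e : Vector A m) → (∀ p → Adj ε (e p)) → A × R₂ → Fin m × Fin 2 → Dart Γ₂
  spoke e ε~e (g , i) (p , j) = dart (g , i) (g ∙ e p , j) (Adj-×R₂⁺ (Adj-from-ε g (ε~e p)))

  spoke-injective : {e : Vector A m} (ε~e : ∀ p → Adj ε (e p)) → Injective _≡_ _≡_ e →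
                    ∀ v → Injective _≡_ _≡_ (spoke e ε~e v)
  spoke-injective ε~e e-injective (g , i) {p , j} {p' , j'} eq
    with e-injective (∙-cancelˡ g _ _ (cong (proj₁ ∘ Dart.head) eq)) | cong (proj₂ ∘ Dart.head) eq
  ... | refl | refl = refl

  module _ {nV nD F : ℕ} (ρ : RotationSystem Γ₂) (V↔ : (A × R₂) ↔ Fin nV) (D↔ : Dart Γ₂ ↔ Fin nD)
           (rep : Fin F → Dart Γ₂)
           (rep-unique : ∀ i j k → iter (RotationSystem.face ρ) k (rep i) ≡ rep j → i ≡ j)
           (euler : 2 * nV + 2 * F ≡ nD)
           {a b c : A} (ε~a : Adj ε a) (ε~b : Adj ε b) (ε~c : Adj ε c)
           (a≢b : a ≢ b) (a≢c : a ≢ c) (b≢c : b ≢ c) where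

    open RotationSystem ρ using (face)
    open RotationSystemProperties ρ

    spokes-≤ : (e : Vector A m) → Injective _≡_ _≡_ e → (∀ p → Adj ε (e p)) → nV * (m * 2) ≤ nD
    spokes-≤ e e-injective ε~e =
      Darts.out-darts-≤ (spoke e ε~e) (λ _ _ → refl) (spoke-injective ε~e e-injective) V↔ (↔-sym *↔×) D↔

    abc : Vector A 3
    abc = a ∷ᵥ b ∷ᵥ c ∷ᵥ []ᵥ

    ε~abc : ∀ p → Adj ε (abc p)
    ε~abc zero             = ε~a
    ε~abc (suc zero)       = ε~b
    ε~abc (suc (suc zero)) = ε~c

    abc-injective : Injective _≡_ _≡_ abc
    abc-injective = distinct₃ a≢b a≢c b≢c

    two-darts : Darts.TwoDartsAtEachVertex {Γ₂}
    two-darts v =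
      spoke abc ε~abc v (zero , zero) , spoke abc ε~abc v (zero , suc zero) , refl , refl ,
      λ eq → r₁≢r₂ (cong proj₂ (spoke-injective ε~abc abc-injective v {zero , zero} {zero , suc zero} eq))
      where
      r₁≢r₂ : _≢_ {A = R₂} zero (suc zero)
      r₁≢r₂ ()

    open Corners rep rep-unique (face-fixpoint-free proj₁) (face²-fixpoint-free two-darts)

    darts-≤ : nD ≤ nV * 6
    darts-≤ = euler-torus-≤ {nV} {F} euler (corners-≤ D↔)

    no-fourth-neighbour : ∀ {y} → Adj ε y → y ≢ a → y ≢ b → y ≢ c → ⊥
    no-fourth-neighbour {y} ε~y y≢a y≢b y≢c = from-no (8 ≤? 6)
      (*-cancelˡ-≤ nV ⦃ nonZeroIndex (Inverse.to V↔ (ε , zero)) ⦄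
        (≤-trans (spokes-≤ (y ∷ᵥ abc) (∷-injective abc-injective y∉abc) ε~yabc) darts-≤))
      where
      y∉abc : ∀ p → abc p ≢ y
      y∉abc zero             a≡y = y≢a (sym a≡y)
      y∉abc (suc zero)       b≡y = y≢b (sym b≡y)
      y∉abc (suc (suc zero)) c≡y = y≢c (sym c≡y)
      ε~yabc : ∀ p → Adj ε ((y ∷ᵥ abc) p)
      ε~yabc zero    = ε~y
      ε~yabc (suc p) = ε~abc p

    three-neighbours : ∀ {y} → Adj ε y → y ≡ a ⊎ y ≡ b ⊎ y ≡ c
    three-neighbours {y} ε~y with y ≟ a | y ≟ b | y ≟ c
    ... | yes y≡a | _       | _       = inj₁ y≡a
    ... | no _    | yes y≡b | _       = inj₂ (inj₁ y≡b)
    ... | no _    | no _    | yes y≡c = inj₂ (inj₂ y≡c)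
    ... | no y≢a  | no y≢b  | no y≢c  = ⊥-elim (no-fourth-neighbour ε~y y≢a y≢b y≢c)

    all-faces-triangular : ∀ d → face (face (face d)) ≡ d
    all-faces-triangular =
      all-faces-triangles D↔ (euler-torus-≥ {nV} {F} euler (spokes-≤ abc abc-injective ε~abc))

    self-inverse-neighbour : ∃ λ x → Adj ε x × x ⁻¹ ≡ x
    self-inverse-neighbour =
      involution-on-three-has-fixpoint ⁻¹-involutive neighbour⁻¹ ε~a ε~b ε~c a≢b a≢c b≢c three-neighbours

    no-embedding : ⊥
    no-embedding with self-inverse-neighbour
    ... | x , ε~x , x⁻¹≡x = face³-fixpoint-free d₀ no-triangle (all-faces-triangular d₀)
      where
      d₀ : Dart Γ₂
      d₀ = dart (ε , zero) (x , zero) (Adj-×R₂⁺ ε~x)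
      no-triangle : ∀ w → Adj₂ (x , zero) w → Adj₂ w (ε , zero) → ⊥
      no-triangle (t , _) x~w w~ε =
        self-inverse-generator-in-no-triangle (self-inverse-neighbour∈C ε~x x⁻¹≡x) x⁻¹≡x
          (Adj-sym (Adj-×R₂⁻ ε∉C w~ε)) (Adj-×R₂⁻ ε∉C x~w)

lemma3p5 : (A : Set) (n : ℕ) → A ↔ Fin n →
    (_∙_ : A → A → A) (ε : A) (_⁻¹ : A → A) → IsGroup _≡_ _∙_ ε _⁻¹ →
    (C : Pred A 0ℓ) → MinimalGenerating _∙_ ε _⁻¹ C →
    Planar (Cay A _∙_ C) → MinDegree≥3 (Cay A _∙_ C) →
    ¬ Embeds2Cell (Cay (A × R₂) (×R₂-mul _∙_) (C ×R₂)) 1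
lemma3p5 A n A↔Fin _∙_ ε _⁻¹ isGroup C minimal _ degree
         (ρ , nV , nD , F , V↔ , D↔ , (rep , _ , rep-unique) , euler)
  with degree ε
... | a , b , c , ε~a , ε~b , ε~c , a≢b , a≢c , b≢c =
  no-embedding ρ V↔ D↔ rep rep-unique (+-cancelʳ-≡ 4 _ _ euler) ε~a ε~b ε~c a≢b a≢c b≢c
  where open TorusEmbedding isGroup (via-injection (↔⇒↣ A↔Fin) _≟ᶠ_) minimal
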